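{- For every integer $n\ge1$, the total number of stumps, summed over all ordered trees with $n$ edges, equals the Catalan number $C_n=\frac{1}{n+1}\binom{2n}{n}$.
   Context: An ordered tree is a rooted tree in which the children of each node are linearly ordered; its size is its number of edges. A stump is a leaf (childless node) whose parent is the root, i.e. a leaf at level one. -}

module Defs where

open import Data.Nat using (ℕ; zero; suc; _+_; _*_; _/_)
open import Data.Nat.Combinatorics using (_C_)
open import Data.List using (List; []; _∷_)

data Tree : Set where
  node : List Tree → Tree

mutual
  size : Tree → ℕ
  size (node ts) = sizeF ts

  sizeF : List Tree → ℕ
  sizeF []       = zero
  sizeF (t ∷ ts) = suc (size t + sizeF ts)

isLeaf : Tree → ℕ
isLeaf (node [])      = 1
isLeaf (node (_ ∷ _)) = 0

countLeaves : List Tree → ℕ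
countLeaves []       = zero
countLeaves (t ∷ ts) = isLeaf t + countLeaves ts

stumps : Tree → ℕ
stumps (node ts) = countLeaves ts

catalan : ℕ → ℕ
catalan n = ((2 * n) C n) / suc n

-- Removing the first subtree a of the root splits a tree with n + 1 edges bijectively into a
-- pair (a , b) with size a + size b = n. So the generating function of trees satisfies
-- T = 1 + x T², and that of stumps satisfies S = x T + x T S (the first child is a stump exactly
-- when a is a single node); hence S + 1 = T. Differentiating T = 1 + x T² and eliminating T²
-- gives (n + 2) Tₙ₊₁ = 2 (2n + 1) Tₙ, the recurrence of binom(2n, n) / (n + 1).
module Submission where

open import Defs
open import Data.Nat using (ℕ; zero; suc; _+_; _*_; _≤_; _≥_; z≤n; s≤s; _/_)
open import Data.List using (List; []; _∷_; _++_; map; cartesianProduct)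
open import Data.Nat.ListAction using (sum)
open import Data.List.Membership.Propositional using (_∈_)
open import Data.List.Relation.Unary.Unique.Propositional using (Unique)
open import Relation.Binary.PropositionalEquality using (_≡_)
open import Function.Bundles using (_⇔_; mk⇔)
open import Data.Nat.Properties
open import Algebra.Properties.CommutativeSemigroup +-commutativeSemigroup using (interchange)
open import Data.Nat.Combinatorics using (_C_; nCk+nC[k+1]≡[n+1]C[k+1]; nCk≡nC[n∸k]; nC1≡n)
open import Data.Nat.DivMod using (m*n/n≡m)
open import Data.Nat.ListAction.Properties using (sum-++; sum-↭)
open import Data.Nat.Tactic.RingSolver using (solve-∀)
open import Data.List.Properties using (map-++; map-∘; map-cong)
open import Data.List.Membership.Propositional.Properties
  using (∈-++⁺ˡ; ∈-++⁺ʳ; ∈-++⁻; ∈-map⁺; ∈-map⁻; ∈-cartesianProduct⁺; ∈-cartesianProduct⁻)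
open import Data.List.Membership.Propositional.Properties.WithK using (unique∧set⇒bag)
open import Data.List.Relation.Binary.BagAndSetEquality using (∼bag⇒↭)
import Data.List.Relation.Binary.Permutation.Propositional.Properties as Perm
open import Data.List.Relation.Unary.Any using (here)
open import Data.List.Relation.Unary.All using ([])
open import Data.List.Relation.Unary.AllPairs using ([]; _∷_)
import Data.List.Relation.Unary.Unique.Propositional.Properties as Unique
open import Data.Product using (∃₂; _×_; _,_; proj₁; proj₂)
open import Data.Sum using (inj₁; inj₂)
open import Relation.Nullary using (¬_)
open import Relation.Binary.PropositionalEquality
  using (refl; sym; trans; cong; cong₂; _≗_; module ≡-Reasoning)
open import Function using (_∘_)
import Function.Properties.Equivalence as ⇔

-- A sequence ℕ → ℕ stands for the generating function Σ f n xⁿ: then ⊛ is the product,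
-- δ is 1, shift is multiplication by x and ∂ is x d/dx.
infixl 7 _⊛_

_⊛_ : (ℕ → ℕ) → (ℕ → ℕ) → ℕ → ℕ
(f ⊛ g) zero    = f 0 * g 0
(f ⊛ g) (suc n) = f 0 * g (suc n) + ((f ∘ suc) ⊛ g) n

δ : ℕ → ℕ
δ zero    = 1
δ (suc _) = 0

shift : (ℕ → ℕ) → ℕ → ℕ
shift f zero    = 0
shift f (suc n) = f n

∂ : (ℕ → ℕ) → ℕ → ℕ
∂ f i = i * f i

⊛-cong : ∀ {f f′ g g′} n → (∀ {i} → i ≤ n → f i ≡ f′ i) → (∀ {j} → j ≤ n → g j ≡ g′ j) →
         (f ⊛ g) n ≡ (f′ ⊛ g′) n
⊛-cong zero    f≈ g≈ = cong₂ _*_ (f≈ z≤n) (g≈ z≤n)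
⊛-cong (suc n) f≈ g≈ = cong₂ _+_ (cong₂ _*_ (f≈ z≤n) (g≈ ≤-refl))
  (⊛-cong n (λ i≤n → f≈ (s≤s i≤n)) (λ j≤n → g≈ (m≤n⇒m≤1+n j≤n)))

⊛-congˡ : ∀ {f f′} g n → f ≗ f′ → (f ⊛ g) n ≡ (f′ ⊛ g) n
⊛-congˡ g n f≗f′ = ⊛-cong n (λ {i} _ → f≗f′ i) (λ _ → refl)

⊛-distribʳ-+ : ∀ f f′ g n → ((λ i → f i + f′ i) ⊛ g) n ≡ (f ⊛ g) n + (f′ ⊛ g) n
⊛-distribʳ-+ f f′ g zero    = *-distribʳ-+ (g 0) (f 0) (f′ 0)
⊛-distribʳ-+ f f′ g (suc n) = trans
  (cong₂ _+_ (*-distribʳ-+ (g (suc n)) (f 0) (f′ 0)) (⊛-distribʳ-+ (f ∘ suc) (f′ ∘ suc) g n))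
  (interchange (f 0 * g (suc n)) (f′ 0 * g (suc n)) _ _)

⊛-distribˡ-+ : ∀ f g g′ n → (f ⊛ (λ j → g j + g′ j)) n ≡ (f ⊛ g) n + (f ⊛ g′) n
⊛-distribˡ-+ f g g′ zero    = *-distribˡ-+ (f 0) (g 0) (g′ 0)
⊛-distribˡ-+ f g g′ (suc n) = trans
  (cong₂ _+_ (*-distribˡ-+ (f 0) (g (suc n)) (g′ (suc n))) (⊛-distribˡ-+ (f ∘ suc) g g′ n))
  (interchange (f 0 * g (suc n)) (f 0 * g′ (suc n)) _ _)

⊛-*ˡ : ∀ c f g n → ((λ i → c * f i) ⊛ g) n ≡ c * (f ⊛ g) n
⊛-*ˡ c f g zero    = *-assoc c (f 0) (g 0)
⊛-*ˡ c f g (suc n) = trans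
  (cong₂ _+_ (*-assoc c (f 0) (g (suc n))) (⊛-*ˡ c (f ∘ suc) g n))
  (sym (*-distribˡ-+ c _ _))

⊛-identityˡ : ∀ g n → (δ ⊛ g) n ≡ g n
⊛-identityˡ g zero    = +-identityʳ (g 0)
⊛-identityˡ g (suc n) =
  trans (cong (1 * g (suc n) +_) (vanishes n)) (trans (+-identityʳ _) (*-identityˡ (g (suc n))))
  where
  vanishes : ∀ m → ((δ ∘ suc) ⊛ g) m ≡ 0
  vanishes zero    = refl
  vanishes (suc m) = vanishes m

⊛-sucʳ : ∀ f g n → (f ⊛ g) (suc n) ≡ (f ⊛ (g ∘ suc)) n + f (suc n) * g 0
⊛-sucʳ f g zero    = refl
⊛-sucʳ f g (suc n) = trans (cong (f 0 * g (suc (suc n)) +_) (⊛-sucʳ (f ∘ suc) g n))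
  (sym (+-assoc (f 0 * g (suc (suc n))) _ _))

⊛-comm : ∀ f g n → (f ⊛ g) n ≡ (g ⊛ f) n
⊛-comm f g zero    = *-comm (f 0) (g 0)
⊛-comm f g (suc n) = begin
  f 0 * g (suc n) + ((f ∘ suc) ⊛ g) n  ≡⟨ cong₂ _+_ (*-comm (f 0) (g (suc n))) (⊛-comm (f ∘ suc) g n) ⟩
  g (suc n) * f 0 + (g ⊛ (f ∘ suc)) n  ≡⟨ +-comm (g (suc n) * f 0) _ ⟩
  (g ⊛ (f ∘ suc)) n + g (suc n) * f 0  ≡⟨ ⊛-sucʳ g f n ⟨
  (g ⊛ f) (suc n)                      ∎
  where open ≡-Reasoning

⊛-assoc : ∀ f g h n → ((f ⊛ g) ⊛ h) n ≡ (f ⊛ (g ⊛ h)) n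
⊛-assoc f g h zero    = *-assoc (f 0) (g 0) (h 0)
⊛-assoc f g h (suc n) = begin
  (f 0 * g 0) * h (suc n) + (((λ i → f 0 * g (suc i) + ((f ∘ suc) ⊛ g) i)) ⊛ h) n
    ≡⟨ cong (c +_) (⊛-distribʳ-+ (λ i → f 0 * g (suc i)) ((f ∘ suc) ⊛ g) h n) ⟩
  (f 0 * g 0) * h (suc n) + (((λ i → f 0 * g (suc i)) ⊛ h) n + (((f ∘ suc) ⊛ g) ⊛ h) n)
    ≡⟨ cong₂ (λ a b → c + (a + b)) (⊛-*ˡ (f 0) (g ∘ suc) h n) (⊛-assoc (f ∘ suc) g h n) ⟩
  (f 0 * g 0) * h (suc n) + (f 0 * ((g ∘ suc) ⊛ h) n + ((f ∘ suc) ⊛ (g ⊛ h)) n)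
    ≡⟨ regroup (f 0) (g 0) (h (suc n)) _ _ ⟩
  f 0 * (g ⊛ h) (suc n) + ((f ∘ suc) ⊛ (g ⊛ h)) n
    ∎
  where
  open ≡-Reasoning
  c : ℕ
  c = (f 0 * g 0) * h (suc n)
  regroup : ∀ a b c d e → (a * b) * c + (a * d + e) ≡ a * (b * c + d) + e
  regroup = solve-∀

∂-⊛ : ∀ f g n → n * (f ⊛ g) n ≡ (∂ f ⊛ g) n + (f ⊛ ∂ g) n
∂-⊛ f g zero    = sym (*-zeroʳ (f 0))
∂-⊛ f g (suc n) = begin
  suc n * (a * b + R)               ≡⟨ expand n a b R ⟩
  R + n * R + a * (suc n * b)       ≡⟨ cong (λ m → R + m + a * (suc n * b)) (∂-⊛ (f ∘ suc) g n) ⟩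
  R + (P + R′) + a * (suc n * b)    ≡⟨ regroup R P R′ (a * (suc n * b)) ⟩
  (R + P) + (a * (suc n * b) + R′)  ≡⟨ cong (_+ (a * (suc n * b) + R′)) (⊛-distribʳ-+ (f ∘ suc) (∂ (f ∘ suc)) g n) ⟨
  (∂ f ⊛ g) (suc n) + (f ⊛ ∂ g) (suc n)  ∎
  where
  open ≡-Reasoning
  a b R P R′ : ℕ
  a = f 0
  b = g (suc n)
  R = ((f ∘ suc) ⊛ g) n
  P = (∂ (f ∘ suc) ⊛ g) n
  R′ = ((f ∘ suc) ⊛ ∂ g) n
  expand : ∀ n a b r → suc n * (a * b + r) ≡ r + n * r + a * (suc n * b)
  expand = solve-∀
  regroup : ∀ r p r′ x → r + (p + r′) + x ≡ (r + p) + (x + r′)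
  regroup = solve-∀

C-absorption : ∀ n k → suc k * (suc n C suc k) ≡ suc n * (n C k)
C-absorption zero    zero    = refl
C-absorption zero    (suc k) = *-zeroʳ (suc (suc k))
C-absorption (suc n) zero    =
  trans (+-identityʳ _) (trans (nC1≡n (suc (suc n))) (sym (*-identityʳ (suc (suc n)))))
C-absorption (suc n) (suc k) = begin
  suc (suc k) * (suc (suc n) C suc (suc k))      ≡⟨ cong (suc (suc k) *_) (nCk+nC[k+1]≡[n+1]C[k+1] (suc n) (suc k)) ⟨
  suc (suc k) * (X + Y)                          ≡⟨ *-distribˡ-+ (suc (suc k)) X Y ⟩
  X + suc k * X + suc (suc k) * Y                ≡⟨ cong₂ (λ a b → X + a + b) (C-absorption n k) (C-absorption n (suc k)) ⟩
  X + suc n * (n C k) + suc n * (n C suc k)      ≡⟨ +-assoc X _ _ ⟩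
  X + (suc n * (n C k) + suc n * (n C suc k))    ≡⟨ cong (X +_) (*-distribˡ-+ (suc n) (n C k) (n C suc k)) ⟨
  X + suc n * (n C k + n C suc k)                ≡⟨ cong (λ m → X + suc n * m) (nCk+nC[k+1]≡[n+1]C[k+1] n k) ⟩
  suc (suc n) * X                                ∎
  where
  open ≡-Reasoning
  X Y : ℕ
  X = suc n C suc k
  Y = suc n C suc (suc k)

central-binomial-recurrence : ∀ n → suc n * (2 * suc n C suc n) ≡ 2 * (suc (2 * n) * (2 * n C n))
central-binomial-recurrence n = begin
  suc n * (2 * suc n C suc n)          ≡⟨ cong (λ m → suc n * (m C suc n)) (*-suc 2 n) ⟩
  suc n * (suc (suc (2 * n)) C suc n)  ≡⟨ cong (suc n *_) (nCk+nC[k+1]≡[n+1]C[k+1] (suc (2 * n)) n) ⟨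
  suc n * (suc (2 * n) C n + X)    ≡⟨ cong (λ m → suc n * (m + X)) symmetric ⟨
  suc n * (X + X)                  ≡⟨ *-distribˡ-+ (suc n) X X ⟩
  suc n * X + suc n * X            ≡⟨ cong (suc n * X +_) (+-identityʳ (suc n * X)) ⟨
  2 * (suc n * X)                  ≡⟨ cong (2 *_) (C-absorption (2 * n) n) ⟩
  2 * (suc (2 * n) * (2 * n C n))  ∎
  where
  open ≡-Reasoning
  X : ℕ
  X = suc (2 * n) C suc n
  symmetric : X ≡ suc (2 * n) C n
  symmetric = trans (nCk≡nC[n∸k] (s≤s (m≤m+n n (n + 0))))
                    (cong (suc (2 * n) C_) (trans (m+n∸m≡n n (n + 0)) (+-identityʳ n)))

module CatalanRecurrence (T : ℕ → ℕ) (T-zero : T 0 ≡ 1) (T-suc : ∀ n → T (suc n) ≡ (T ⊛ T) n) where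

  private
    Q U Y W : ℕ → ℕ
    Q = T ⊛ T
    U = T ⊛ ∂ T
    Y = shift Q ⊛ T
    W = shift U ⊛ T

    T≗δ+xQ : T ≗ λ i → δ i + shift Q i
    T≗δ+xQ zero    = T-zero
    T≗δ+xQ (suc n) = T-suc n

    ∂T≗xQ+2xU : ∂ T ≗ λ i → shift Q i + 2 * shift U i
    ∂T≗xQ+2xU zero    = refl
    ∂T≗xQ+2xU (suc n) = begin
      suc n * T (suc n)          ≡⟨ cong (suc n *_) (T-suc n) ⟩
      Q n + n * Q n              ≡⟨ cong (Q n +_) (∂-⊛ T T n) ⟩
      Q n + ((∂ T ⊛ T) n + U n)  ≡⟨ cong (λ m → Q n + (m + U n)) (⊛-comm (∂ T) T n) ⟩
      Q n + (U n + U n)          ≡⟨ cong (λ m → Q n + (U n + m)) (+-identityʳ (U n)) ⟨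
      Q n + 2 * U n              ∎
      where open ≡-Reasoning

    T-⊛ : ∀ g n → (T ⊛ g) n ≡ g n + (shift Q ⊛ g) n
    T-⊛ g n = begin
      (T ⊛ g) n                            ≡⟨ ⊛-congˡ g n T≗δ+xQ ⟩
      ((λ i → δ i + shift Q i) ⊛ g) n      ≡⟨ ⊛-distribʳ-+ δ (shift Q) g n ⟩
      (δ ⊛ g) n + (shift Q ⊛ g) n          ≡⟨ cong (_+ (shift Q ⊛ g) n) (⊛-identityˡ g n) ⟩
      g n + (shift Q ⊛ g) n                ∎
      where open ≡-Reasoning

    U≡Y+2W : ∀ n → U n ≡ Y n + 2 * W n
    U≡Y+2W n = begin
      (T ⊛ ∂ T) n                                        ≡⟨ ⊛-comm T (∂ T) n ⟩
      (∂ T ⊛ T) n                                        ≡⟨ ⊛-congˡ T n ∂T≗xQ+2xU ⟩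
      ((λ i → shift Q i + 2 * shift U i) ⊛ T) n          ≡⟨ ⊛-distribʳ-+ (shift Q) _ T n ⟩
      Y n + ((λ i → 2 * shift U i) ⊛ T) n                ≡⟨ cong (Y n +_) (⊛-*ˡ 2 (shift U) T n) ⟩
      Y n + 2 * W n                                      ∎
      where open ≡-Reasoning

    xQ⊛∂T≡W : ∀ n → (shift Q ⊛ ∂ T) n ≡ W n
    xQ⊛∂T≡W zero    = refl
    xQ⊛∂T≡W (suc n) = trans (⊛-assoc T T (∂ T) n) (⊛-comm T U n)

    U≡∂T+W : ∀ n → U n ≡ ∂ T n + W n
    U≡∂T+W n = trans (T-⊛ (∂ T) n) (cong (∂ T n +_) (xQ⊛∂T≡W n))

    ∂T≡Y+W : ∀ n → ∂ T n ≡ Y n + W n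
    ∂T≡Y+W n = +-cancelʳ-≡ (W n) (∂ T n) (Y n + W n) (begin
      ∂ T n + W n        ≡⟨ U≡∂T+W n ⟨
      U n                ≡⟨ U≡Y+2W n ⟩
      Y n + 2 * W n      ≡⟨ cong (Y n +_) (cong (W n +_) (+-identityʳ (W n))) ⟩
      Y n + (W n + W n)  ≡⟨ +-assoc (Y n) (W n) (W n) ⟨
      Y n + W n + W n    ∎)
      where open ≡-Reasoning

    Q+U≡T+2∂T : ∀ n → Q n + U n ≡ T n + 2 * ∂ T n
    Q+U≡T+2∂T n = begin
      Q n + U n                      ≡⟨ cong₂ _+_ (T-⊛ T n) (U≡∂T+W n) ⟩
      (T n + Y n) + (∂ T n + W n)    ≡⟨ interchange (T n) (Y n) (∂ T n) (W n) ⟩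
      (T n + ∂ T n) + (Y n + W n)    ≡⟨ cong (T n + ∂ T n +_) (∂T≡Y+W n) ⟨
      (T n + ∂ T n) + ∂ T n          ≡⟨ +-assoc (T n) (∂ T n) (∂ T n) ⟩
      T n + (∂ T n + ∂ T n)          ≡⟨ cong (λ m → T n + (∂ T n + m)) (+-identityʳ (∂ T n)) ⟨
      T n + 2 * ∂ T n                ∎
      where open ≡-Reasoning

  recurrence : ∀ n → suc (suc n) * T (suc n) ≡ 2 * (suc (2 * n) * T n)
  recurrence n = begin
    T (suc n) + ∂ T (suc n)      ≡⟨ cong₂ _+_ (T-suc n) (∂T≗xQ+2xU (suc n)) ⟩
    Q n + (Q n + 2 * U n)        ≡⟨ double (Q n) (U n) ⟩
    2 * (Q n + U n)              ≡⟨ cong (2 *_) (Q+U≡T+2∂T n) ⟩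
    2 * (T n + 2 * (n * T n))    ≡⟨ cong (λ m → 2 * (T n + m)) (*-assoc 2 n (T n)) ⟨
    2 * (suc (2 * n) * T n)      ∎
    where
    open ≡-Reasoning
    double : ∀ q u → q + (q + 2 * u) ≡ 2 * (q + u)
    double = solve-∀

  [1+n]*T≡[2n]Cn : ∀ n → suc n * T n ≡ 2 * n C n
  [1+n]*T≡[2n]Cn zero    = trans (+-identityʳ (T 0)) T-zero
  [1+n]*T≡[2n]Cn (suc n) = *-cancelˡ-≡ _ _ (suc n) (begin
    suc n * (suc (suc n) * T (suc n))        ≡⟨ cong (suc n *_) (recurrence n) ⟩
    suc n * (2 * (suc (2 * n) * T n))        ≡⟨ regroup n (T n) ⟩
    2 * (suc (2 * n) * (suc n * T n))        ≡⟨ cong (λ m → 2 * (suc (2 * n) * m)) ([1+n]*T≡[2n]Cn n) ⟩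
    2 * (suc (2 * n) * (2 * n C n))          ≡⟨ central-binomial-recurrence n ⟨
    suc n * (2 * suc n C suc n)              ∎)
    where
    open ≡-Reasoning
    regroup : ∀ n t → suc n * (2 * (suc (2 * n) * t)) ≡ 2 * (suc (2 * n) * (suc n * t))
    regroup = solve-∀

  catalan≡ : ∀ n → catalan n ≡ T n
  catalan≡ n = begin
    (2 * n C n) / suc n      ≡⟨ cong (_/ suc n) ([1+n]*T≡[2n]Cn n) ⟨
    (suc n * T n) / suc n    ≡⟨ cong (_/ suc n) (*-comm (suc n) (T n)) ⟩
    (T n * suc n) / suc n    ≡⟨ m*n/n≡m (T n) (suc n) ⟩
    T n                      ∎
    where open ≡-Reasoning

∑ : {A : Set} → (A → ℕ) → List A → ℕ
∑ h xs = sum (map h xs)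

module _ {A : Set} where

  ∑-++ : ∀ (h : A → ℕ) xs ys → ∑ h (xs ++ ys) ≡ ∑ h xs + ∑ h ys
  ∑-++ h xs ys = trans (cong sum (map-++ h xs ys)) (sum-++ (map h xs) (map h ys))

  ∑-cong : ∀ {h h′ : A → ℕ} → h ≗ h′ → ∀ xs → ∑ h xs ≡ ∑ h′ xs
  ∑-cong h≗h′ xs = cong sum (map-cong h≗h′ xs)

  ∑-+ : ∀ (h h′ : A → ℕ) xs → ∑ (λ x → h x + h′ x) xs ≡ ∑ h xs + ∑ h′ xs
  ∑-+ h h′ []       = refl
  ∑-+ h h′ (x ∷ xs) = trans (cong (h x + h′ x +_) (∑-+ h h′ xs)) (interchange (h x) (h′ x) _ _)

  ∑-*ˡ : ∀ c (h : A → ℕ) xs → ∑ (λ x → c * h x) xs ≡ c * ∑ h xs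
  ∑-*ˡ c h []       = sym (*-zeroʳ c)
  ∑-*ˡ c h (x ∷ xs) = trans (cong (c * h x +_) (∑-*ˡ c h xs)) (sym (*-distribˡ-+ c (h x) _))

  ∑-unique-set : ∀ (h : A → ℕ) {xs ys} → Unique xs → Unique ys →
                 (∀ {x} → x ∈ xs ⇔ x ∈ ys) → ∑ h xs ≡ ∑ h ys
  ∑-unique-set h xs! ys! xs⇔ys = sum-↭ (Perm.map⁺ h (∼bag⇒↭ (unique∧set⇒bag xs! ys! xs⇔ys)))

∑-map : {A B : Set} (h : B → ℕ) (g : A → B) (xs : List A) → ∑ h (map g xs) ≡ ∑ (h ∘ g) xs
∑-map h g xs = cong sum (sym (map-∘ xs))

module _ {A B : Set} where

  ∑-cartesianProduct : (u : A → ℕ) (v : B → ℕ) (xs : List A) (ys : List B) →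
    ∑ (λ p → u (proj₁ p) * v (proj₂ p)) (cartesianProduct xs ys) ≡ ∑ u xs * ∑ v ys
  ∑-cartesianProduct u v []       ys = refl
  ∑-cartesianProduct u v (x ∷ xs) ys = begin
    ∑ uv (map (x ,_) ys ++ cartesianProduct xs ys)        ≡⟨ ∑-++ uv (map (x ,_) ys) _ ⟩
    ∑ uv (map (x ,_) ys) + ∑ uv (cartesianProduct xs ys)  ≡⟨ cong₂ _+_ (trans (∑-map uv (x ,_) ys) (∑-*ˡ (u x) v ys))
                                                                        (∑-cartesianProduct u v xs ys) ⟩
    u x * ∑ v ys + ∑ u xs * ∑ v ys                        ≡⟨ *-distribʳ-+ (∑ v ys) (u x) _ ⟨
    (u x + ∑ u xs) * ∑ v ys                               ∎
    where
    open ≡-Reasoning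
    uv : A × B → ℕ
    uv p = u (proj₁ p) * v (proj₂ p)

  infixl 7 _⊛ᴸ_

  _⊛ᴸ_ : (ℕ → List A) → (ℕ → List B) → ℕ → List (A × B)
  (F ⊛ᴸ G) zero    = cartesianProduct (F 0) (G 0)
  (F ⊛ᴸ G) (suc n) = cartesianProduct (F 0) (G (suc n)) ++ ((F ∘ suc) ⊛ᴸ G) n

  ∑-⊛ᴸ : (u : A → ℕ) (v : B → ℕ) (F : ℕ → List A) (G : ℕ → List B) (n : ℕ) →
    ∑ (λ p → u (proj₁ p) * v (proj₂ p)) ((F ⊛ᴸ G) n) ≡ ((∑ u ∘ F) ⊛ (∑ v ∘ G)) n
  ∑-⊛ᴸ u v F G zero    = ∑-cartesianProduct u v (F 0) (G 0)
  ∑-⊛ᴸ u v F G (suc n) = trans (∑-++ _ (cartesianProduct (F 0) (G (suc n))) _)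
    (cong₂ _+_ (∑-cartesianProduct u v (F 0) (G (suc n))) (∑-⊛ᴸ u v (F ∘ suc) G n))

  ∈-⊛ᴸ⁻ : ∀ (F : ℕ → List A) (G : ℕ → List B) n {a b} → (a , b) ∈ (F ⊛ᴸ G) n →
    ∃₂ λ i j → i + j ≡ n × a ∈ F i × b ∈ G j
  ∈-⊛ᴸ⁻ F G zero ab∈ with ∈-cartesianProduct⁻ (F 0) (G 0) ab∈
  ... | a∈ , b∈ = 0 , 0 , refl , a∈ , b∈
  ∈-⊛ᴸ⁻ F G (suc n) ab∈ with ∈-++⁻ (cartesianProduct (F 0) (G (suc n))) ab∈
  ... | inj₁ ab∈′ with ∈-cartesianProduct⁻ (F 0) (G (suc n)) ab∈′
  ...   | a∈ , b∈ = 0 , suc n , refl , a∈ , b∈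
  ∈-⊛ᴸ⁻ F G (suc n) ab∈ | inj₂ ab∈′ with ∈-⊛ᴸ⁻ (F ∘ suc) G n ab∈′
  ...   | i , j , i+j≡n , a∈ , b∈ = suc i , j , cong suc i+j≡n , a∈ , b∈

  ∈-⊛ᴸ⁺ : ∀ (F : ℕ → List A) (G : ℕ → List B) n {a b} i j →
    i + j ≡ n → a ∈ F i → b ∈ G j → (a , b) ∈ (F ⊛ᴸ G) n
  ∈-⊛ᴸ⁺ F G zero    zero    zero _    a∈ b∈ = ∈-cartesianProduct⁺ a∈ b∈
  ∈-⊛ᴸ⁺ F G (suc n) zero    j    refl a∈ b∈ = ∈-++⁺ˡ (∈-cartesianProduct⁺ a∈ b∈)
  ∈-⊛ᴸ⁺ F G (suc n) (suc i) j    i+j≡n a∈ b∈ = ∈-++⁺ʳ (cartesianProduct (F 0) (G (suc n)))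
    (∈-⊛ᴸ⁺ (F ∘ suc) G n i j (suc-injective i+j≡n) a∈ b∈)

  ⊛ᴸ-unique : ∀ (F : ℕ → List A) (G : ℕ → List B) n → (∀ i → Unique (F i)) → (∀ j → Unique (G j)) →
    (∀ {a i i′} → a ∈ F i → a ∈ F i′ → i ≡ i′) → Unique ((F ⊛ᴸ G) n)
  ⊛ᴸ-unique F G zero    F! G! _       = Unique.cartesianProduct⁺ (F! 0) (G! 0)
  ⊛ᴸ-unique F G (suc n) F! G! F-index = Unique.++⁺ (Unique.cartesianProduct⁺ (F! 0) (G! (suc n)))
    (⊛ᴸ-unique (F ∘ suc) G n (F! ∘ suc) G! (λ a∈ a∈′ → suc-injective (F-index a∈ a∈′)))
    disjoint
    where
    disjoint : ∀ {p} → ¬ (p ∈ cartesianProduct (F 0) (G (suc n)) × p ∈ ((F ∘ suc) ⊛ᴸ G) n)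
    disjoint (p∈ , p∈′) with ∈-cartesianProduct⁻ (F 0) (G (suc n)) p∈ | ∈-⊛ᴸ⁻ (F ∘ suc) G n p∈′
    ... | a∈ , _ | _ , _ , _ , a∈′ , _ with F-index a∈ a∈′
    ... | ()

graft : Tree × Tree → Tree
graft (a , node ts) = node (a ∷ ts)

graft-injective : ∀ {p q} → graft p ≡ graft q → p ≡ q
graft-injective {_ , node _} {_ , node _} refl = refl

-- The bound is recursion fuel: enum bound n lists the trees with n edges only when n ≤ bound.
enum : (bound n : ℕ) → List Tree
enum _           zero    = node [] ∷ []
enum zero        (suc n) = []
enum (suc bound) (suc n) = map graft ((enum bound ⊛ᴸ enum bound) n)

enum-sound : ∀ bound n {t} → t ∈ enum bound n → size t ≡ n
enum-sound bound       zero    (here refl) = refl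
enum-sound (suc bound) (suc n) t∈ with ∈-map⁻ graft t∈
... | (a , node ts) , p∈ , refl with ∈-⊛ᴸ⁻ (enum bound) (enum bound) n p∈
...   | i , j , i+j≡n , a∈ , ts∈ =
  cong suc (trans (cong₂ _+_ (enum-sound bound i a∈) (enum-sound bound j ts∈)) i+j≡n)

enum-complete : ∀ {bound n} t → n ≤ bound → size t ≡ n → t ∈ enum bound n
enum-complete {n = zero}          (node [])       _         _  = here refl
enum-complete {suc bound} {suc n} (node (a ∷ ts)) (s≤s n≤b) eq =
  ∈-map⁺ graft (∈-⊛ᴸ⁺ (enum bound) (enum bound) n (size a) (sizeF ts) size≡n
    (enum-complete a (≤-trans (m≤m+n (size a) (sizeF ts)) (≤-trans (≤-reflexive size≡n) n≤b)) refl)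
    (enum-complete (node ts) (≤-trans (m≤n+m (sizeF ts) (size a)) (≤-trans (≤-reflexive size≡n) n≤b)) refl))
  where
  size≡n : size a + sizeF ts ≡ n
  size≡n = suc-injective eq

enum-unique : ∀ bound n → Unique (enum bound n)
enum-unique _           zero    = [] ∷ []
enum-unique zero        (suc n) = []
enum-unique (suc bound) (suc n) = Unique.map⁺ graft-injective
  (⊛ᴸ-unique (enum bound) (enum bound) n (enum-unique bound) (enum-unique bound)
    (λ a∈ a∈′ → trans (sym (enum-sound bound _ a∈)) (enum-sound bound _ a∈′)))

Enumerates : ℕ → List Tree → Set
Enumerates n ts = Unique ts × (∀ t → t ∈ ts ⇔ size t ≡ n)

enum-enumerates : ∀ {bound n} → n ≤ bound → Enumerates n (enum bound n)
enum-enumerates {bound} {n} n≤b =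
  enum-unique bound n , λ t → mk⇔ (enum-sound bound n) (enum-complete t n≤b)

∑-Enumerates : ∀ h {n xs ys} → Enumerates n xs → Enumerates n ys → ∑ h xs ≡ ∑ h ys
∑-Enumerates h (xs! , xs-spec) (ys! , ys-spec) =
  ∑-unique-set h xs! ys! (⇔.trans (xs-spec _) (⇔.sym (ys-spec _)))

trees : ℕ → List Tree
trees n = enum n n

splits : ℕ → List (Tree × Tree)
splits n = (enum n ⊛ᴸ enum n) n

∑ᵀ : (Tree → ℕ) → ℕ → ℕ
∑ᵀ h n = ∑ h (trees n)

∑ᵀ-graft : ∀ (u v : Tree → ℕ) n →
  ∑ (λ p → u (proj₁ p) * v (proj₂ p)) (splits n) ≡ (∑ᵀ u ⊛ ∑ᵀ v) n
∑ᵀ-graft u v n = trans (∑-⊛ᴸ u v (enum n) (enum n) n) (⊛-cong n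
  (λ i≤n → ∑-Enumerates u (enum-enumerates i≤n) (enum-enumerates ≤-refl))
  (λ j≤n → ∑-Enumerates v (enum-enumerates j≤n) (enum-enumerates ≤-refl)))

treeCount stumpCount : ℕ → ℕ
treeCount  = ∑ᵀ λ _ → 1
stumpCount = ∑ᵀ stumps

treeCount-suc : ∀ n → treeCount (suc n) ≡ (treeCount ⊛ treeCount) n
treeCount-suc n = trans (∑-map (λ _ → 1) graft (splits n)) (∑ᵀ-graft (λ _ → 1) (λ _ → 1) n)

∑ᵀ-isLeaf : ∑ᵀ isLeaf ≗ δ
∑ᵀ-isLeaf zero    = refl
∑ᵀ-isLeaf (suc n) =
  trans (∑-map isLeaf graft (splits n)) (trans (∑-cong isLeaf-graft (splits n)) (∑-zero (splits n)))
  where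
  isLeaf-graft : ∀ p → isLeaf (graft p) ≡ 0
  isLeaf-graft (_ , node _) = refl
  ∑-zero : ∀ (ps : List (Tree × Tree)) → ∑ (λ _ → 0) ps ≡ 0
  ∑-zero []       = refl
  ∑-zero (_ ∷ ps) = ∑-zero ps

stumpCount-suc : ∀ n → stumpCount (suc n) ≡ (δ ⊛ treeCount) n + (treeCount ⊛ stumpCount) n
stumpCount-suc n = begin
  ∑ stumps (map graft pairs)                                        ≡⟨ ∑-map stumps graft pairs ⟩
  ∑ (stumps ∘ graft) pairs                                          ≡⟨ ∑-cong stumps-graft pairs ⟩
  ∑ (λ p → leaf p + stump p) pairs                                  ≡⟨ ∑-+ leaf stump pairs ⟩
  ∑ leaf pairs + ∑ stump pairs                                      ≡⟨ cong₂ _+_ (∑ᵀ-graft isLeaf (λ _ → 1) n)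
                                                                                  (∑ᵀ-graft (λ _ → 1) stumps n) ⟩
  (∑ᵀ isLeaf ⊛ treeCount) n + (treeCount ⊛ stumpCount) n           ≡⟨ cong (_+ (treeCount ⊛ stumpCount) n)
                                                                           (⊛-congˡ treeCount n ∑ᵀ-isLeaf) ⟩
  (δ ⊛ treeCount) n + (treeCount ⊛ stumpCount) n                   ∎
  where
  open ≡-Reasoning
  pairs : List (Tree × Tree)
  pairs = splits n
  leaf stump : Tree × Tree → ℕ
  leaf  p = isLeaf (proj₁ p) * 1
  stump p = 1 * stumps (proj₂ p)
  stumps-graft : ∀ p → stumps (graft p) ≡ leaf p + stump p
  stumps-graft (a , node ts) = cong₂ _+_ (sym (*-identityʳ (isLeaf a))) (sym (+-identityʳ (countLeaves ts)))

⊛-recurrence-unique : ∀ {T A B} → A 0 ≡ B 0 →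
  (∀ n → A (suc n) ≡ (T ⊛ A) n) → (∀ n → B (suc n) ≡ (T ⊛ B) n) → A ≗ B
⊛-recurrence-unique {T} {A} {B} A₀≡B₀ A-suc B-suc n = bounded n ≤-refl
  where
  bounded : ∀ m {n} → n ≤ m → A n ≡ B n
  bounded _       {zero}  _         = A₀≡B₀
  bounded (suc m) {suc n} (s≤s n≤m) = begin
    A (suc n)    ≡⟨ A-suc n ⟩
    (T ⊛ A) n    ≡⟨ ⊛-cong n (λ _ → refl) (λ j≤n → bounded m (≤-trans j≤n n≤m)) ⟩
    (T ⊛ B) n    ≡⟨ B-suc n ⟨
    B (suc n)    ∎
    where open ≡-Reasoning

stumpCount+δ≗treeCount : (λ n → stumpCount n + δ n) ≗ treeCount
stumpCount+δ≗treeCount = ⊛-recurrence-unique refl stumpCount+δ-suc treeCount-suc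
  where
  open ≡-Reasoning
  stumpCount+δ-suc : ∀ n → stumpCount (suc n) + 0 ≡ (treeCount ⊛ (λ j → stumpCount j + δ j)) n
  stumpCount+δ-suc n = begin
    stumpCount (suc n) + 0                                   ≡⟨ +-identityʳ _ ⟩
    stumpCount (suc n)                                       ≡⟨ stumpCount-suc n ⟩
    (δ ⊛ treeCount) n + (treeCount ⊛ stumpCount) n           ≡⟨ +-comm ((δ ⊛ treeCount) n) _ ⟩
    (treeCount ⊛ stumpCount) n + (δ ⊛ treeCount) n           ≡⟨ cong ((treeCount ⊛ stumpCount) n +_)
                                                                     (⊛-comm δ treeCount n) ⟩
    (treeCount ⊛ stumpCount) n + (treeCount ⊛ δ) n           ≡⟨ ⊛-distribˡ-+ treeCount stumpCount δ n ⟨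
    (treeCount ⊛ (λ j → stumpCount j + δ j)) n               ∎

open CatalanRecurrence treeCount refl treeCount-suc using (catalan≡)

proposition9 : (n : ℕ) → n ≥ 1 → (ts : List Tree) → Unique ts →
    ((t : Tree) → (t ∈ ts) ⇔ (size t ≡ n)) →
    sum (map stumps ts) ≡ catalan n
proposition9 n@(suc _) _ ts ts! ts-spec = begin
  sum (map stumps ts)   ≡⟨ ∑-Enumerates stumps (ts! , ts-spec) (enum-enumerates ≤-refl) ⟩
  stumpCount n          ≡⟨ +-identityʳ (stumpCount n) ⟨
  stumpCount n + δ n    ≡⟨ stumpCount+δ≗treeCount n ⟩
  treeCount n           ≡⟨ catalan≡ n ⟨
  catalan n             ∎
  where open ≡-Reasoning
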